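{- Let $Q$ be a complete quiver and let $j$ be a mutable vertex which is cycle-preserving for $Q$ and is not the apex of a vortex subquiver of $Q$. Then every oriented 3-cycle in $\mu_j(Q)$ contains $j$, and $\mu_j(Q)$ is vortex-free.
   Context: Quiver: finite directed graph without loops or oriented 2-cycles, vertices partitioned into mutable and frozen, arrows between frozen vertices ignored. Mutation $\mu_j$: for each path $i\xrightarrow{a}j\xrightarrow{b}k$ add $ab$ arrows $i\to k$, reverse arrows at $j$, cancel 2-cycles. Complete: at least one arrow between every pair of vertices at least one of which is mutable. A 3-vertex (sub)quiver is an oriented 3-cycle if it has at most one frozen vertex and its underlying directed graph is not acyclic. $j$ is cycle-preserving for $Q$ if whenever $Q|_{ijk}$ is an oriented 3-cycle containing $j$, so is $\mu_j(Q)|_{ijk}$. A vortex is a 4-vertex quiver with at least three mutable vertices, one vertex (the apex) a source or sink and the other three supporting an oriented cycle; a quiver is vortex-free if no 4-vertex subquiver is a vortex. -}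

module Defs where

open import Data.Nat using (ℕ; zero; suc; _+_; _*_; _∸_; _<_; _≤_)
open import Data.Fin using (Fin; _≟_)
open import Data.Bool using (Bool; true; false; if_then_else_; _∨_)
open import Data.List using (List; []; _∷_)
open import Data.Product using (_×_; ∃-syntax)
open import Data.Sum using (_⊎_)
open import Relation.Nullary using (¬_; does)
open import Relation.Binary.PropositionalEquality using (_≡_; _≢_)

record RawQuiver (n : ℕ) : Set where
  field
    arr    : Fin n → Fin n → ℕ     -- arr i k = number of arrows i → k
    frozen : Fin n → Bool
open RawQuiver public

record IsQuiver {n : ℕ} (Q : RawQuiver n) : Set where
  field
    noLoop    : ∀ i → arr Q i i ≡ 0
    no2cycle  : ∀ i k → arr Q i k ≡ 0 ⊎ arr Q k i ≡ 0

Frozen : ∀ {n} → RawQuiver n → Fin n → Set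
Frozen Q v = frozen Q v ≡ true

Mutable : ∀ {n} → RawQuiver n → Fin n → Set
Mutable Q v = frozen Q v ≡ false

Arrow : ∀ {n} → RawQuiver n → Fin n → Fin n → Set
Arrow Q i k = 0 < arr Q i k

-- Mutation at j: for every path i → j → k add (#i→j)(#j→k) arrows
-- i → k, reverse all arrows incident to j, and cancel 2-cycles.
-- For i, k ≠ j the number of arrows i → k after adding the composite
-- arrows is  arr i k + arr i j * arr j k , and in the opposite direction
-- arr k i + arr k j * arr j i ; cancelling 2-cycles leaves the truncated
-- difference.
μ : ∀ {n} → Fin n → RawQuiver n → RawQuiver n
arr (μ j Q) i k =
  if does (i ≟ j) ∨ does (k ≟ j)
  then arr Q k i
  else (arr Q i k + arr Q i j * arr Q j k) ∸ (arr Q k i + arr Q k j * arr Q j i)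
frozen (μ j Q) = frozen Q

nFrozen : ∀ {n} → RawQuiver n → List (Fin n) → ℕ
nFrozen Q [] = 0
nFrozen Q (v ∷ vs) = (if frozen Q v then 1 else 0) + nFrozen Q vs

Complete : ∀ {n} → RawQuiver n → Set
Complete Q = ∀ i k → i ≢ k → (Mutable Q i ⊎ Mutable Q k) → Arrow Q i k ⊎ Arrow Q k i

-- With no loops and no 2-cycles
-- a directed cycle on three vertices goes through all three, in one of
-- the two cyclic orders.
HasCycle3 : ∀ {n} → RawQuiver n → Fin n → Fin n → Fin n → Set
HasCycle3 Q a b c =
  (Arrow Q a b × Arrow Q b c × Arrow Q c a) ⊎ (Arrow Q a c × Arrow Q c b × Arrow Q b a)

Distinct3 : ∀ {n} → Fin n → Fin n → Fin n → Set
Distinct3 a b c = a ≢ b × a ≢ c × b ≢ c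

Oriented3Cycle : ∀ {n} → RawQuiver n → Fin n → Fin n → Fin n → Set
Oriented3Cycle Q a b c =
  Distinct3 a b c × nFrozen Q (a ∷ b ∷ c ∷ []) ≤ 1 × HasCycle3 Q a b c

CyclePreserving : ∀ {n} → RawQuiver n → Fin n → Set
CyclePreserving Q j =
  ∀ i k → Oriented3Cycle Q i j k → Oriented3Cycle (μ j Q) i j k

IsSource4 : ∀ {n} → RawQuiver n → Fin n → Fin n → Fin n → Fin n → Set
IsSource4 Q a b c d = ¬ Arrow Q b a × ¬ Arrow Q c a × ¬ Arrow Q d a

IsSink4 : ∀ {n} → RawQuiver n → Fin n → Fin n → Fin n → Fin n → Set
IsSink4 Q a b c d = ¬ Arrow Q a b × ¬ Arrow Q a c × ¬ Arrow Q a d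

Vortex : ∀ {n} → RawQuiver n → Fin n → Fin n → Fin n → Fin n → Set
Vortex Q a b c d =
  (Distinct3 a b c × a ≢ d × b ≢ d × c ≢ d)
  × nFrozen Q (a ∷ b ∷ c ∷ d ∷ []) ≤ 1
  × (IsSource4 Q a b c d ⊎ IsSink4 Q a b c d)
  × HasCycle3 Q b c d

IsVortexApex : ∀ {n} → RawQuiver n → Fin n → Set
IsVortexApex Q a = ∃[ b ] ∃[ c ] ∃[ d ] Vortex Q a b c d

VortexFree : ∀ {n} → RawQuiver n → Set
VortexFree Q = ∀ a b c d → ¬ Vortex Q a b c d

{-# OPTIONS --safe #-}
module Submission where

-- Cycle preservation at j turns every path x → j → y of Q into an arrow
-- x → y of μ_j Q: if y → x, the 3-cycle x → j → y → x must survive mutation,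
-- which forces x → y; otherwise nothing cancels the composite arrows.  Hence no
-- arrow of a 3-cycle of μ_j Q avoiding j runs from an out-neighbour of j to an
-- in-neighbour, so (by completeness) its three vertices lie on the same side
-- of j; mutation leaves the arrows among them alone, and with j as apex they
-- form a vortex of Q.  For a vortex of μ_j Q, j lies on its 3-cycle and so has
-- an in- and an out-neighbour there; however the apex is joined to j, either
-- the reversed arrow between them or an arrow created along a path through j
-- contradicts the apex being a source or a sink.

open import Defs
open import Data.Nat using (ℕ)
open import Data.Fin using (Fin)
open import Data.Product using (_×_)
open import Data.Sum using (_⊎_)
open import Relation.Nullary using (¬_)
open import Relation.Binary.PropositionalEquality using (_≡_)

open import Data.Bool using (true; false)
open import Data.Bool.Properties using (∨-zeroʳ)
open import Data.Empty using (⊥-elim)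
open import Data.Fin using (_≟_)
open import Data.List using (List; []; _∷_; _++_)
open import Data.List.Membership.Propositional using (_∈_)
import Data.List.Membership.DecPropositional as DecMembership
open import Data.List.Relation.Unary.All using ([]; _∷_; lookup)
open import Data.List.Relation.Unary.Any using (here; there)
open import Data.Nat using (_+_; _*_; _∸_; _<_; _≤_; _<?_; z≤n; s≤s)
open import Data.Nat.Properties
  using (≤-trans; ≤-total; ≤-reflexive; ≤⇒≯; ≮⇒≥; n≤0⇒n≡0; m≤n+m; *-mono-≤; *-zeroʳ; +-identityʳ;
         n∸n≡0; 0∸n≡0; m≤n⇒m∸n≡0; n>0⇒n≢0)
open import Data.Product using (_,_; ∃-syntax; map₂; swap)
open import Data.Sum using (inj₁; inj₂; [_,_]′; map)
open import Function using (_∘_; id)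
open import Relation.Nullary using (yes; no; does)
open import Relation.Nullary.Decidable using (dec-true; dec-false)
open import Relation.Binary.PropositionalEquality
  using (refl; sym; trans; cong; cong₂; subst; _≢_; module ≡-Reasoning)
open ≡-Reasoning

private
  variable
    n : ℕ
    Q Q′ : RawQuiver n
    a b c d i j k x y : Fin n
    xs ys : List (Fin n)

two-colouring-of-cycle-constant : {A B C A′ B′ C′ : Set} → A ⊎ A′ → B ⊎ B′ → C ⊎ C′ →
  ¬ (A′ × B) → ¬ (B′ × C) → ¬ (C′ × A) → (A × B × C) ⊎ (A′ × B′ × C′)
two-colouring-of-cycle-constant (inj₁ a) (inj₁ b) (inj₁ c) _ _ _ = inj₁ (a , b , c)
two-colouring-of-cycle-constant (inj₂ a) (inj₂ b) (inj₂ c) _ _ _ = inj₂ (a , b , c)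
two-colouring-of-cycle-constant (inj₁ a) (inj₁ _) (inj₂ c) _ _ ca = ⊥-elim (ca (c , a))
two-colouring-of-cycle-constant (inj₁ a) (inj₂ _) (inj₂ c) _ _ ca = ⊥-elim (ca (c , a))
two-colouring-of-cycle-constant (inj₁ _) (inj₂ b) (inj₁ c) _ bc _ = ⊥-elim (bc (b , c))
two-colouring-of-cycle-constant (inj₂ _) (inj₂ b) (inj₁ c) _ bc _ = ⊥-elim (bc (b , c))
two-colouring-of-cycle-constant (inj₂ a) (inj₁ b) _ ab _ _ = ⊥-elim (ab (a , b))

∈-triple⇒≡ : x ∈ a ∷ b ∷ c ∷ [] → a ≡ x ⊎ b ≡ x ⊎ c ≡ x
∈-triple⇒≡ (here refl) = inj₁ refl
∈-triple⇒≡ (there (here refl)) = inj₂ (inj₁ refl)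
∈-triple⇒≡ (there (there (here refl))) = inj₂ (inj₂ refl)
∈-triple⇒≡ (there (there (there ())))

arr-reverse≡0 : IsQuiver Q → Arrow Q x y → arr Q y x ≡ 0
arr-reverse≡0 {x = x} {y} isQ x→y =
  [ ⊥-elim ∘ n>0⇒n≢0 x→y , id ]′ (IsQuiver.no2cycle isQ x y)

Arrow-asym : IsQuiver Q → Arrow Q x y → ¬ Arrow Q y x
Arrow-asym isQ x→y y→x = n>0⇒n≢0 y→x (arr-reverse≡0 isQ x→y)

Arrow⇒≢ : IsQuiver Q → Arrow Q x y → x ≢ y
Arrow⇒≢ isQ x→x refl = Arrow-asym isQ x→x x→x

path⇒ends-≢ : IsQuiver Q → Arrow Q x j → Arrow Q j y → x ≢ y
path⇒ends-≢ isQ x→j j→x refl = Arrow-asym isQ x→j j→x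

HasCycle3-map : (P : Fin n → Set) → (∀ {x y} → P x → P y → Arrow Q x y → Arrow Q′ x y) →
  P a → P b → P c → HasCycle3 Q a b c → HasCycle3 Q′ a b c
HasCycle3-map P f pa pb pc (inj₁ (ab , bc , ca)) = inj₁ (f pa pb ab , f pb pc bc , f pc pa ca)
HasCycle3-map P f pa pb pc (inj₂ (ac , cb , ba)) = inj₂ (f pa pc ac , f pc pb cb , f pb pa ba)

HasCycle3-successor : HasCycle3 Q a b c → x ∈ a ∷ b ∷ c ∷ [] →
  ∃[ y ] y ∈ a ∷ b ∷ c ∷ [] × Arrow Q x y
HasCycle3-successor (inj₁ (ab , _ , _)) (here refl) = _ , there (here refl) , ab
HasCycle3-successor (inj₂ (ac , _ , _)) (here refl) = _ , there (there (here refl)) , ac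
HasCycle3-successor (inj₁ (_ , bc , _)) (there (here refl)) = _ , there (there (here refl)) , bc
HasCycle3-successor (inj₂ (_ , _ , ba)) (there (here refl)) = _ , here refl , ba
HasCycle3-successor (inj₁ (_ , _ , ca)) (there (there (here refl))) = _ , here refl , ca
HasCycle3-successor (inj₂ (_ , cb , _)) (there (there (here refl))) = _ , there (here refl) , cb

HasCycle3-predecessor : HasCycle3 Q a b c → x ∈ a ∷ b ∷ c ∷ [] →
  ∃[ y ] y ∈ a ∷ b ∷ c ∷ [] × Arrow Q y x
HasCycle3-predecessor (inj₁ (_ , _ , ca)) (here refl) = _ , there (there (here refl)) , ca
HasCycle3-predecessor (inj₂ (_ , _ , ba)) (here refl) = _ , there (here refl) , ba
HasCycle3-predecessor (inj₁ (ab , _ , _)) (there (here refl)) = _ , here refl , ab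
HasCycle3-predecessor (inj₂ (_ , cb , _)) (there (here refl)) = _ , there (there (here refl)) , cb
HasCycle3-predecessor (inj₁ (_ , bc , _)) (there (there (here refl))) = _ , there (here refl) , bc
HasCycle3-predecessor (inj₂ (ac , _ , _)) (there (there (here refl))) = _ , here refl , ac

NotBothFrozen : RawQuiver n → Fin n → Fin n → Set
NotBothFrozen Q x y = ¬ (Frozen Q x × Frozen Q y)

nFrozen-mono-∷ : (x : Fin n) → nFrozen Q xs ≤ nFrozen Q (x ∷ xs)
nFrozen-mono-∷ _ = m≤n+m _ _

nFrozen>0 : x ∈ xs → Frozen Q x → 0 < nFrozen Q xs
nFrozen>0 (here refl) fx rewrite fx = s≤s z≤n
nFrozen>0 (there x∈) fx = ≤-trans (nFrozen>0 x∈ fx) (m≤n+m _ _)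

nFrozen>1 : x ∈ xs → y ∈ xs → x ≢ y → Frozen Q x → Frozen Q y → 1 < nFrozen Q xs
nFrozen>1 (here refl) (here refl) x≢y _ _ = ⊥-elim (x≢y refl)
nFrozen>1 (here refl) (there y∈) _ fx fy rewrite fx = s≤s (nFrozen>0 y∈ fy)
nFrozen>1 (there x∈) (here refl) _ fx fy rewrite fy = s≤s (nFrozen>0 x∈ fx)
nFrozen>1 (there x∈) (there y∈) x≢y fx fy = ≤-trans (nFrozen>1 x∈ y∈ x≢y fx fy) (m≤n+m _ _)

nFrozen≤1⇒NotBothFrozen : nFrozen Q xs ≤ 1 → x ∈ xs → y ∈ xs → x ≢ y → NotBothFrozen Q x y
nFrozen≤1⇒NotBothFrozen fr x∈ y∈ x≢y (fx , fy) = ≤⇒≯ fr (nFrozen>1 x∈ y∈ x≢y fx fy)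

Oriented3Cycle⇒NotBothFrozen : Oriented3Cycle Q a b c →
  NotBothFrozen Q a b × NotBothFrozen Q b c × NotBothFrozen Q a c
Oriented3Cycle⇒NotBothFrozen {Q = Q} {a} {b} {c} ((a≢b , a≢c , b≢c) , fr , _) =
  notBoth (here refl) (there (here refl)) a≢b ,
  notBoth (there (here refl)) (there (there (here refl))) b≢c ,
  notBoth (here refl) (there (there (here refl))) a≢c
  where
    notBoth : x ∈ a ∷ b ∷ c ∷ [] → y ∈ a ∷ b ∷ c ∷ [] → x ≢ y → NotBothFrozen Q x y
    notBoth = nFrozen≤1⇒NotBothFrozen {Q = Q} fr

NotBothFrozen⇒nFrozen≤1 : NotBothFrozen Q x y → nFrozen Q (x ∷ y ∷ []) ≤ 1
NotBothFrozen⇒nFrozen≤1 {Q = Q} {x} {y} nb with frozen Q x | frozen Q y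
... | true  | true  = ⊥-elim (nb (refl , refl))
... | true  | false = s≤s z≤n
... | false | true  = s≤s z≤n
... | false | false = z≤n

nFrozen-insert-mutable : (Q : RawQuiver n) (xs : List (Fin n)) →
  Mutable Q j → nFrozen Q (xs ++ j ∷ ys) ≡ nFrozen Q (xs ++ ys)
nFrozen-insert-mutable Q [] mj rewrite mj = refl
nFrozen-insert-mutable Q (_ ∷ xs) mj = cong (_ +_) (nFrozen-insert-mutable Q xs mj)

μ-arr-from-centre : (k : Fin n) → arr (μ j Q) j k ≡ arr Q k j
μ-arr-from-centre {j = j} k rewrite dec-true (j ≟ j) refl = refl

μ-arr-to-centre : (k : Fin n) → arr (μ j Q) k j ≡ arr Q j k
μ-arr-to-centre {j = j} k rewrite dec-true (j ≟ j) refl | ∨-zeroʳ (does (k ≟ j)) = refl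

μ-arr-away : i ≢ j → k ≢ j →
  arr (μ j Q) i k ≡ (arr Q i k + arr Q i j * arr Q j k) ∸ (arr Q k i + arr Q k j * arr Q j i)
μ-arr-away {i = i} {j} {k} i≢j k≢j rewrite dec-false (i ≟ j) i≢j | dec-false (k ≟ j) k≢j = refl

m∸n≡0⊎n∸m≡0 : ∀ m n → m ∸ n ≡ 0 ⊎ n ∸ m ≡ 0
m∸n≡0⊎n∸m≡0 m n = map m≤n⇒m∸n≡0 m≤n⇒m∸n≡0 (≤-total m n)

μ-isQuiver : IsQuiver Q → IsQuiver (μ j Q)
μ-isQuiver {Q = Q} {j = j} isQ = record { noLoop = noLoop′ ; no2cycle = no2cycle′ }
  where
    open IsQuiver isQ
    noLoop′ : ∀ i → arr (μ j Q) i i ≡ 0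
    noLoop′ i with i ≟ j
    ... | yes refl = noLoop j
    ... | no _     = n∸n≡0 (arr Q i i + arr Q i j * arr Q j i)
    no2cycle′ : ∀ i k → arr (μ j Q) i k ≡ 0 ⊎ arr (μ j Q) k i ≡ 0
    no2cycle′ i k with i ≟ j | k ≟ j
    ... | yes _ | yes _ = no2cycle k i
    ... | yes _ | no _  = no2cycle k i
    ... | no _  | yes _ = no2cycle k i
    ... | no _  | no _  =
      m∸n≡0⊎n∸m≡0 (arr Q i k + arr Q i j * arr Q j k) (arr Q k i + arr Q k j * arr Q j i)

μ-arr-unchanged : IsQuiver Q → x ≢ j → y ≢ j →
  arr Q x j * arr Q j y ≡ 0 → arr Q y j * arr Q j x ≡ 0 → arr (μ j Q) x y ≡ arr Q x y
μ-arr-unchanged {Q = Q} {x} {j} {y} isQ x≢j y≢j xjy≡0 yjx≡0 = begin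
  arr (μ j Q) x y
    ≡⟨ μ-arr-away {Q = Q} x≢j y≢j ⟩
  (arr Q x y + arr Q x j * arr Q j y) ∸ (arr Q y x + arr Q y j * arr Q j x)
    ≡⟨ cong₂ (λ p q → (arr Q x y + p) ∸ (arr Q y x + q)) xjy≡0 yjx≡0 ⟩
  (arr Q x y + 0) ∸ (arr Q y x + 0)
    ≡⟨ cong₂ _∸_ (+-identityʳ (arr Q x y)) (+-identityʳ (arr Q y x)) ⟩
  arr Q x y ∸ arr Q y x
    ≡⟨ ∸-of-absent (IsQuiver.no2cycle isQ x y) ⟩
  arr Q x y ∎
  where
    ∸-of-absent : ∀ {m n} → m ≡ 0 ⊎ n ≡ 0 → m ∸ n ≡ m
    ∸-of-absent {n = n} (inj₁ refl) = 0∸n≡0 n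
    ∸-of-absent (inj₂ refl) = refl

module CyclePreservingCentre {n} {Q : RawQuiver n} (isQ : IsQuiver Q)
                             {j : Fin n} (mj : Mutable Q j) (cp : CyclePreserving Q j) where

  open DecMembership (_≟_ {n}) using (_∈?_)

  path⇒μ-arrow : Arrow Q x j → Arrow Q j y → NotBothFrozen Q x y → Arrow (μ j Q) x y
  path⇒μ-arrow {x} {y} x→j j→y nb with 0 <? arr Q y x
  ... | no y↛x =
    subst (0 <_) (sym μ-arr-xy) (≤-trans (*-mono-≤ x→j j→y) (m≤n+m _ (arr Q x y)))
    where
      μ-arr-xy : arr (μ j Q) x y ≡ arr Q x y + arr Q x j * arr Q j y
      μ-arr-xy rewrite μ-arr-away {Q = Q} (Arrow⇒≢ isQ x→j) (Arrow⇒≢ isQ j→y ∘ sym)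
                     | n≤0⇒n≡0 (≮⇒≥ y↛x) | arr-reverse≡0 isQ j→y = refl
  ... | yes y→x with cp x y (triangle , fr , inj₁ (x→j , j→y , y→x))
    where
      triangle : Distinct3 x j y
      triangle = Arrow⇒≢ isQ x→j , path⇒ends-≢ isQ x→j j→y , Arrow⇒≢ isQ j→y
      fr : nFrozen Q (x ∷ j ∷ y ∷ []) ≤ 1
      fr = ≤-trans (≤-reflexive (nFrozen-insert-mutable {ys = y ∷ []} Q (x ∷ []) mj))
                     (NotBothFrozen⇒nFrozen≤1 {Q = Q} nb)
  ...   | _ , _ , inj₁ (μx→j , _ , _) =
    ⊥-elim (Arrow-asym isQ x→j (subst (0 <_) (μ-arr-to-centre {Q = Q} x) μx→j))
  ...   | _ , _ , inj₂ (μx→y , _ , _) = μx→y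

  μ-no-arrow-out-to-in : NotBothFrozen Q x y → Arrow (μ j Q) x y → ¬ (Arrow Q j x × Arrow Q y j)
  μ-no-arrow-out-to-in nb x→y (j→x , y→j) =
    Arrow-asym (μ-isQuiver isQ) x→y (path⇒μ-arrow y→j j→x (nb ∘ swap))

  μ-arr-among-in-neighbours : Arrow Q x j → Arrow Q y j → arr (μ j Q) x y ≡ arr Q x y
  μ-arr-among-in-neighbours {x} {y} x→j y→j =
    μ-arr-unchanged isQ (Arrow⇒≢ isQ x→j) (Arrow⇒≢ isQ y→j)
      (trans (cong (arr Q x j *_) (arr-reverse≡0 isQ y→j)) (*-zeroʳ (arr Q x j)))
      (trans (cong (arr Q y j *_) (arr-reverse≡0 isQ x→j)) (*-zeroʳ (arr Q y j)))

  μ-arr-among-out-neighbours : Arrow Q j x → Arrow Q j y → arr (μ j Q) x y ≡ arr Q x y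
  μ-arr-among-out-neighbours {x} {y} j→x j→y =
    μ-arr-unchanged isQ (Arrow⇒≢ isQ j→x ∘ sym) (Arrow⇒≢ isQ j→y ∘ sym)
      (cong (_* arr Q j y) (arr-reverse≡0 isQ j→x))
      (cong (_* arr Q j x) (arr-reverse≡0 isQ j→y))

  μ-cycle-sides-agree : Oriented3Cycle (μ j Q) a b c →
    Arrow Q a j ⊎ Arrow Q j a → Arrow Q b j ⊎ Arrow Q j b → Arrow Q c j ⊎ Arrow Q j c →
    (Arrow Q a j × Arrow Q b j × Arrow Q c j) ⊎ (Arrow Q j a × Arrow Q j b × Arrow Q j c)
  μ-cycle-sides-agree o@(_ , _ , hc) sa sb sc with Oriented3Cycle⇒NotBothFrozen o | hc
  ... | nab , nbc , nac | inj₁ (a→b , b→c , c→a) =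
    two-colouring-of-cycle-constant sa sb sc
      (μ-no-arrow-out-to-in nab a→b) (μ-no-arrow-out-to-in nbc b→c)
      (μ-no-arrow-out-to-in (nac ∘ swap) c→a)
  ... | nab , nbc , nac | inj₂ (a→c , c→b , b→a) =
    map (map₂ swap) (map₂ swap) (two-colouring-of-cycle-constant sa sc sb
      (μ-no-arrow-out-to-in nac a→c) (μ-no-arrow-out-to-in (nbc ∘ swap) c→b)
      (μ-no-arrow-out-to-in (nab ∘ swap) b→a))

  module _ (cQ : Complete Q) where

    adjacent-to-centre : x ≢ j → Arrow Q x j ⊎ Arrow Q j x
    adjacent-to-centre x≢j = cQ _ j x≢j (inj₂ mj)

    μ-cycle-avoiding-centre⇒vortex : a ≢ j → b ≢ j → c ≢ j → Oriented3Cycle (μ j Q) a b c →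
      IsVortexApex Q j
    μ-cycle-avoiding-centre⇒vortex {a} {b} {c} a≢j b≢j c≢j o@((a≢b , a≢c , b≢c) , fr , hc) =
      a , b , c , distinct , fr′ ,
      apex-and-cycle (μ-cycle-sides-agree o (adjacent-to-centre a≢j) (adjacent-to-centre b≢j)
                                            (adjacent-to-centre c≢j))
      where
        distinct : Distinct3 j a b × j ≢ c × a ≢ c × b ≢ c
        distinct = (a≢j ∘ sym , b≢j ∘ sym , a≢b) , c≢j ∘ sym , a≢c , b≢c
        fr′ : nFrozen Q (j ∷ a ∷ b ∷ c ∷ []) ≤ 1
        fr′ = ≤-trans (≤-reflexive (nFrozen-insert-mutable {ys = a ∷ b ∷ c ∷ []} Q [] mj)) fr
        apex-and-cycle :
          (Arrow Q a j × Arrow Q b j × Arrow Q c j) ⊎ (Arrow Q j a × Arrow Q j b × Arrow Q j c) →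
          (IsSource4 Q j a b c ⊎ IsSink4 Q j a b c) × HasCycle3 Q a b c
        apex-and-cycle (inj₁ (a→j , b→j , c→j)) =
          inj₂ (Arrow-asym isQ a→j , Arrow-asym isQ b→j , Arrow-asym isQ c→j) ,
          HasCycle3-map {Q = μ j Q} {Q′ = Q} (λ x → Arrow Q x j)
            (λ x→j y→j → subst (0 <_) (μ-arr-among-in-neighbours x→j y→j)) a→j b→j c→j hc
        apex-and-cycle (inj₂ (j→a , j→b , j→c)) =
          inj₁ (Arrow-asym isQ j→a , Arrow-asym isQ j→b , Arrow-asym isQ j→c) ,
          HasCycle3-map {Q = μ j Q} {Q′ = Q} (λ x → Arrow Q j x)
            (λ j→x j→y → subst (0 <_) (μ-arr-among-out-neighbours j→x j→y)) j→a j→b j→c hc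

    μ-cycle-contains-centre : ¬ IsVortexApex Q j → Oriented3Cycle (μ j Q) a b c → j ∈ a ∷ b ∷ c ∷ []
    μ-cycle-contains-centre {a} {b} {c} no-vortex o with j ∈? a ∷ b ∷ c ∷ []
    ... | yes j∈ = j∈
    ... | no j∉ = ⊥-elim (no-vortex (μ-cycle-avoiding-centre⇒vortex
                     (j∉ ∘ here ∘ sym) (j∉ ∘ there ∘ here ∘ sym) (j∉ ∘ there ∘ there ∘ here ∘ sym) o))

    μ-arrow-into-from-cycle-through-centre : HasCycle3 (μ j Q) b c d → j ∈ b ∷ c ∷ d ∷ [] → a ≢ j →
      (∀ {x} → x ∈ b ∷ c ∷ d ∷ [] → NotBothFrozen Q x a) →
      ∃[ x ] x ∈ b ∷ c ∷ d ∷ [] × Arrow (μ j Q) x a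
    μ-arrow-into-from-cycle-through-centre {a = a} hc j∈ a≢j nb with adjacent-to-centre a≢j
    ... | inj₁ a→j = j , j∈ , subst (0 <_) (sym (μ-arr-from-centre {Q = Q} a)) a→j
    ... | inj₂ j→a with HasCycle3-successor {Q = μ j Q} hc j∈
    ...   | x , x∈ , μj→x =
      x , x∈ , path⇒μ-arrow (subst (0 <_) (μ-arr-from-centre {Q = Q} x) μj→x) j→a (nb x∈)

    μ-arrow-out-to-cycle-through-centre : HasCycle3 (μ j Q) b c d → j ∈ b ∷ c ∷ d ∷ [] → a ≢ j →
      (∀ {x} → x ∈ b ∷ c ∷ d ∷ [] → NotBothFrozen Q a x) →
      ∃[ x ] x ∈ b ∷ c ∷ d ∷ [] × Arrow (μ j Q) a x
    μ-arrow-out-to-cycle-through-centre {a = a} hc j∈ a≢j nb with adjacent-to-centre a≢j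
    ... | inj₂ j→a = j , j∈ , subst (0 <_) (sym (μ-arr-to-centre {Q = Q} a)) j→a
    ... | inj₁ a→j with HasCycle3-predecessor {Q = μ j Q} hc j∈
    ...   | x , x∈ , μx→j =
      x , x∈ , path⇒μ-arrow a→j (subst (0 <_) (μ-arr-to-centre {Q = Q} x) μx→j) (nb x∈)

    μ-vortex-free : ¬ IsVortexApex Q j → VortexFree (μ j Q)
    μ-vortex-free no-vortex a b c d (((a≢b , a≢c , b≢c) , a≢d , b≢d , c≢d) , fr , apex , hc) =
      [ no-source , no-sink ]′ apex
      where
        j∈ : j ∈ b ∷ c ∷ d ∷ []
        j∈ = μ-cycle-contains-centre no-vortex
               ((b≢c , b≢d , c≢d) , ≤-trans (nFrozen-mono-∷ {Q = Q} {xs = b ∷ c ∷ d ∷ []} a) fr , hc)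
        a≢ : x ∈ b ∷ c ∷ d ∷ [] → a ≢ x
        a≢ = lookup (a≢b ∷ a≢c ∷ a≢d ∷ [])
        a-notBoth : x ∈ b ∷ c ∷ d ∷ [] → NotBothFrozen Q a x
        a-notBoth x∈ =
          nFrozen≤1⇒NotBothFrozen {Q = Q} {xs = a ∷ b ∷ c ∷ d ∷ []} fr (here refl) (there x∈) (a≢ x∈)
        no-source : ¬ IsSource4 (μ j Q) a b c d
        no-source (b↛a , c↛a , d↛a) =
          let x , x∈ , x→a =
                μ-arrow-into-from-cycle-through-centre hc j∈ (a≢ j∈) ((_∘ swap) ∘ a-notBoth)
          in lookup (b↛a ∷ c↛a ∷ d↛a ∷ []) x∈ x→a
        no-sink : ¬ IsSink4 (μ j Q) a b c d
        no-sink (a↛b , a↛c , a↛d) =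
          let x , x∈ , a→x = μ-arrow-out-to-cycle-through-centre hc j∈ (a≢ j∈) a-notBoth
          in lookup (a↛b ∷ a↛c ∷ a↛d ∷ []) x∈ a→x

proposition3p11 : (n : ℕ) (Q : RawQuiver n) → IsQuiver Q → Complete Q →
    (j : Fin n) → Mutable Q j → CyclePreserving Q j → ¬ IsVortexApex Q j →
    (∀ a b c → Oriented3Cycle (μ j Q) a b c → a ≡ j ⊎ b ≡ j ⊎ c ≡ j)
    × VortexFree (μ j Q)
proposition3p11 n Q isQ cQ j mj cp no-vortex =
  (λ a b c o → ∈-triple⇒≡ (μ-cycle-contains-centre cQ no-vortex o)) , μ-vortex-free cQ no-vortex
  where open CyclePreservingCentre isQ mj cp
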